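{- If $t \to_{n}^{(m,e)} p$ with $p \in \mathsf{no}_n$, then there exist a context $\Gamma$ and a type $\sigma$ and a tight derivation in system $\mathcal{N}$ of $\Gamma \vdash^{(m,e,|p|_n)} t : \sigma$.
   Context: Terms. Fix a countably infinite set of variables. Terms are $t,u,r ::= x \mid \lambda x.t \mid t\,u \mid t[x\backslash u]$, where $t[x\backslash u]$ (an explicit substitution) binds $x$ in $t$; terms are taken modulo $\alpha$-conversion and $t\{x:=u\}$ denotes capture-avoiding meta-level substitution. List contexts are $L ::= \square \mid L[x\backslash t]$, and $L\langle t\rangle$ is the result of plugging $t$ into the hole. CBN neutral and normal terms: $\mathsf{ne}_n ::= x \mid \mathsf{ne}_n\, t$ and $\mathsf{no}_n ::= \lambda x.\mathsf{no}_n \mid \mathsf{ne}_n$. The $n$-size is $|x|_n=0$, $|\lambda x.t|_n = |t|_n+1$, $|t\,u|_n = |t|_n+1$, $|t[x\backslash u]|_n = |t|_n$. Reduction. Rule $\mathtt{dB}$: $(L\langle \lambda x.t\rangle)\,u \mapsto L\langle t[x\backslash u]\rangle$; rule $\mathtt{sn}$: $t[x\backslash u] \mapsto t\{x:=u\}$. CBN contexts are $N ::= \square \mid N\,t \mid \lambda x.N \mid N[x\backslash u]$, and $\to_n$ is the closure of $\mathtt{dB}\cup\mathtt{sn}$ under CBN contexts. $\mathtt{dB}$-steps are multiplicative ($m$-steps), $\mathtt{sn}$-steps are exponential ($e$-steps). $t \to_n^{(m,e)} p$ means $t$ reduces to $p$ in finitely many $\to_n$ steps, exactly $m$ of which are $m$-steps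 and $e$ of which are $e$-steps. Types. Tight types: $\mathtt{tt} ::= \mathtt{n} \mid \mathtt{a}$. Types: $\sigma,\tau ::= \mathtt{tt} \mid \mathcal{M} \mid \mathcal{M}\to\sigma$, where multitypes $\mathcal{M} = [\sigma_i]_{i\in I}$ are finite multisets of types ($[\,]$ empty, $\sqcup$ union). A typing context $\Gamma$ maps variables to multitypes, $[\,]$ for all but finitely many; $\mathrm{dom}(\Gamma)=\{x \mid \Gamma(x)\neq[\,]\}$; $(\Gamma+\Delta)(x) = \Gamma(x)\sqcup\Delta(x)$, extended to finite sums $+_{i\in I}\Gamma_i$ (the empty context if $I=\emptyset$); $\Gamma\setminus\!\!\setminus x$ maps $x$ to $[\,]$ and agrees with $\Gamma$ elsewhere; $\Gamma; x:\mathcal{M}$ is the context mapping $x$ to $\mathcal{M}$ and agreeing with $\Gamma$ elsewhere, where $x\notin\mathrm{dom}(\Gamma)$. Judgements $\Gamma \vdash^{(m,e,s)} t:\sigma$ carry natural-number counters. System $\mathcal{N}$ consists of the rules: (app$_p$) from $\Gamma\vdash^{(m,e,s)} t:\mathtt{n}$ infer $\Gamma\vdash^{(m,e,s+1)} t\,u:\mathtt{n}$; (abs$_p$) from $\Gamma\vdash^{(m,e,s)} t:\mathtt{tt}$ (a tight type) with $\Gamma(x)$ tight, infer $\Gamma\setminus\!\!\setminus x\vdash^{(m,e,s+1)}\lambda x.t:\mathtt{a}$; (var$_c$) $x:[\sigma]\vdash^{(0,0,0)} x:\sigma$; (abs$_c$) from $\Gamma\vdash^{(m,e,s)} t:\tau$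 infer $\Gamma\setminus\!\!\setminus x\vdash^{(m,e,s)}\lambda x.t:\Gamma(x)\to\tau$; (app$_c$) from $\Gamma\vdash^{(m,e,s)} t:[\sigma_i]_{i\in I}\to\tau$ and $\Delta_i\vdash^{(m_i,e_i,s_i)} u:\sigma_i$ for each $i\in I$, infer $\Gamma+_{i\in I}\Delta_i\vdash^{(1+m+\sum_i m_i,\,1+e+\sum_i e_i,\,s+\sum_i s_i)} t\,u:\tau$; (es$_c$) from $\Gamma;x:[\sigma_i]_{i\in I}\vdash^{(m,e,s)} t:\tau$ and $\Delta_i\vdash^{(m_i,e_i,s_i)} u:\sigma_i$ for each $i\in I$, infer $(\Gamma\setminus\!\!\setminus x)+_{i\in I}\Delta_i\vdash^{(m+\sum_i m_i,\,1+e+\sum_i e_i,\,s+\sum_i s_i)} t[x\backslash u]:\tau$. A multitype is tight if all its elements are tight types; a context is tight if all multitypes it assigns are tight; a derivation of $\Gamma\vdash^{(m,e,s)} t:\sigma$ is tight if $\Gamma$ is tight and $\sigma$ is a tight type. -}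

module Defs where

open import Data.Nat using (ℕ; zero; suc; _+_)
open import Data.Fin using (Fin; zero; suc)
open import Data.List using (List; []; _∷_; _++_; [_])
open import Data.List.Relation.Unary.All using (All)
open import Data.List.Relation.Binary.Pointwise using (Pointwise)
open import Data.List.Relation.Binary.Permutation.Propositional using (_↭_)
open import Data.Product using (Σ; _×_)

-- Terms (well-scoped de Bruijn; α-equivalence is syntactic identity)
-- Term n : terms with free variables among Fin n.
-- es t u  represents  t[x\u]  where x is the variable 0 bound in t.

data Term (n : ℕ) : Set where
  var : Fin n → Term n
  lam : Term (suc n) → Term n
  app : Term n → Term n → Term n
  es  : Term (suc n) → Term n → Term n

Ren : ℕ → ℕ → Set
Ren n m = Fin n → Fin m

extR : ∀ {n m} → Ren n m → Ren (suc n) (suc m)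
extR ρ zero    = zero
extR ρ (suc i) = suc (ρ i)

rename : ∀ {n m} → Ren n m → Term n → Term m
rename ρ (var x)  = var (ρ x)
rename ρ (lam t)  = lam (rename (extR ρ) t)
rename ρ (app t u) = app (rename ρ t) (rename ρ u)
rename ρ (es t u) = es (rename (extR ρ) t) (rename ρ u)

weaken : ∀ {n} → Term n → Term (suc n)
weaken = rename suc

Sub : ℕ → ℕ → Set
Sub n m = Fin n → Term m

extS : ∀ {n m} → Sub n m → Sub (suc n) (suc m)
extS σ zero    = var zero
extS σ (suc i) = weaken (σ i)

subst : ∀ {n m} → Sub n m → Term n → Term m
subst σ (var x)   = σ x
subst σ (lam t)   = lam (subst (extS σ) t)
subst σ (app t u) = app (subst σ t) (subst σ u)
subst σ (es t u)  = es (subst (extS σ) t) (subst σ u)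

sub0 : ∀ {n} → Term n → Sub (suc n) n
sub0 u zero    = u
sub0 u (suc i) = var i

_[0:=_] : ∀ {n} → Term (suc n) → Term n → Term n
t [0:= u ] = subst (sub0 u) t

-- List contexts  L ::= □ | L[x\t]
-- LCtx n m : plugging a term of scope m yields a term of scope n.
-- (ext L t) is L[x\t], and (ext L t)⟨s⟩ = (L⟨s⟩)[x\t].

data LCtx : ℕ → ℕ → Set where
  hole : ∀ {n} → LCtx n n
  ext  : ∀ {n m} → LCtx (suc n) m → Term n → LCtx n m

plug : ∀ {n m} → LCtx n m → Term m → Term n
plug hole     s = s
plug (ext L t) s = es (plug L s) t

-- moving a term of the outer scope under the binders of L
liftL : ∀ {n m} → LCtx n m → Term n → Term m
liftL hole      u = u
liftL (ext L t) u = liftL L (weaken u)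

data Kind : Set where
  mul expo : Kind   -- dB-steps (m-steps), sn-steps (e-steps)

data _⟶n[_]_ {n : ℕ} : Term n → Kind → Term n → Set where
  dB   : ∀ {m} (L : LCtx n m) (t : Term (suc m)) (u : Term n) →
         app (plug L (lam t)) u ⟶n[ mul ] plug L (es t (liftL L u))
  sn   : (t : Term (suc n)) (u : Term n) → es t u ⟶n[ expo ] (t [0:= u ])
  appL : ∀ {k t t'} (u : Term n) → t ⟶n[ k ] t' → app t u ⟶n[ k ] app t' u
  lamN : ∀ {k} {t t' : Term (suc n)} → t ⟶n[ k ] t' → lam t ⟶n[ k ] lam t'
  esL  : ∀ {k} {t t' : Term (suc n)} (u : Term n) → t ⟶n[ k ] t' → es t u ⟶n[ k ] es t' u

data _⟶n*⟨_,_⟩_ {n : ℕ} : Term n → ℕ → ℕ → Term n → Set where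
  done  : ∀ {t} → t ⟶n*⟨ 0 , 0 ⟩ t
  stepM : ∀ {t t' p m e} → t ⟶n[ mul ] t' → t' ⟶n*⟨ m , e ⟩ p → t ⟶n*⟨ suc m , e ⟩ p
  stepE : ∀ {t t' p m e} → t ⟶n[ expo ] t' → t' ⟶n*⟨ m , e ⟩ p → t ⟶n*⟨ m , suc e ⟩ p

data NeN {n : ℕ} : Term n → Set where
  var : ∀ x → NeN (var x)
  app : ∀ {t} → NeN t → (u : Term n) → NeN (app t u)

data NoN {n : ℕ} : Term n → Set where
  lam : ∀ {t : Term (suc n)} → NoN t → NoN (lam t)
  ne  : ∀ {t} → NeN t → NoN t

size : ∀ {n} → Term n → ℕ
size (var x)   = 0
size (lam t)   = suc (size t)
size (app t u) = suc (size t)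
size (es t u)  = size t

-- Types.  Multitypes (finite multisets) are represented by lists, and
-- compared up to (nested) multiset equality _≈M_ wherever the typing
-- rules require two multitypes / types to coincide.

data TT : Set where
  tn ta : TT

data Ty : Set where
  tight : TT → Ty
  mty   : List Ty → Ty
  _⇒_   : List Ty → Ty → Ty

MTy : Set
MTy = List Ty

mutual
  data _≈T_ : Ty → Ty → Set where
    tight≈ : ∀ a → tight a ≈T tight a
    mty≈   : ∀ {M N} → M ≈M N → mty M ≈T mty N
    arr≈   : ∀ {M N σ τ} → M ≈M N → σ ≈T τ → (M ⇒ σ) ≈T (N ⇒ τ)

  data _≈M_ : MTy → MTy → Set where
    bag≈ : ∀ {M K N} → M ↭ K → Pointwise _≈T_ K N → M ≈M N

data IsTight : Ty → Set where
  tightT : ∀ a → IsTight (tight a)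

TightM : MTy → Set
TightM M = All IsTight M

Ctx : ℕ → Set
Ctx n = Fin n → MTy

∅ : ∀ {n} → Ctx n
∅ _ = []

_+C_ : ∀ {n} → Ctx n → Ctx n → Ctx n
(Γ +C Δ) x = Γ x ++ Δ x

single : ∀ {n} → Fin n → MTy → Ctx n
single zero    M zero    = M
single zero    M (suc _) = []
single (suc x) M zero    = []
single (suc x) M (suc y) = single x M y

drop0 : ∀ {n} → Ctx (suc n) → Ctx n
drop0 Γ i = Γ (suc i)

TightCtx : ∀ {n} → Ctx n → Set
TightCtx Γ = ∀ x → TightM (Γ x)

-- System N.   Γ ⊢⟨ m , e , s ⟩ t ∶ σ
-- For a term of scope suc n, a context Γ' : Ctx (suc n) is exactly
-- "Γ; x : Γ' 0" with Γ = drop0 Γ'.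

mutual
  data _⊢⟨_,_,_⟩_∶_ {n : ℕ} : Ctx n → ℕ → ℕ → ℕ → Term n → Ty → Set where
    app-p : ∀ {Γ m e s t} (u : Term n) →
            Γ ⊢⟨ m , e , s ⟩ t ∶ tight tn →
            Γ ⊢⟨ m , e , suc s ⟩ app t u ∶ tight tn
    abs-p : ∀ {Γ m e s a} {t : Term (suc n)} →
            Γ ⊢⟨ m , e , s ⟩ t ∶ tight a → TightM (Γ zero) →
            drop0 Γ ⊢⟨ m , e , suc s ⟩ lam t ∶ tight ta
    var-c : ∀ x σ → single x [ σ ] ⊢⟨ 0 , 0 , 0 ⟩ var x ∶ σ
    abs-c : ∀ {Γ m e s τ} {t : Term (suc n)} →
            Γ ⊢⟨ m , e , s ⟩ t ∶ τ →
            drop0 Γ ⊢⟨ m , e , s ⟩ lam t ∶ (Γ zero ⇒ τ)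
    app-c : ∀ {Γ Δ m e s m' e' s' t u M N τ} →
            Γ ⊢⟨ m , e , s ⟩ t ∶ (M ⇒ τ) →
            Δ ⊢⟨ m' , e' , s' ⟩ u ∶* N → N ≈M M →
            (Γ +C Δ) ⊢⟨ suc (m + m') , suc (e + e') , s + s' ⟩ app t u ∶ τ
    es-c  : ∀ {Γ Δ m e s m' e' s' τ N} {t : Term (suc n)} {u : Term n} →
            Γ ⊢⟨ m , e , s ⟩ t ∶ τ →
            Δ ⊢⟨ m' , e' , s' ⟩ u ∶* N → N ≈M Γ zero →
            (drop0 Γ +C Δ) ⊢⟨ m + m' , suc (e + e') , s + s' ⟩ es t u ∶ τ

  data _⊢⟨_,_,_⟩_∶*_ {n : ℕ} : Ctx n → ℕ → ℕ → ℕ → Term n → MTy → Set where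
    []  : ∀ {u} → ∅ ⊢⟨ 0 , 0 , 0 ⟩ u ∶* []
    _∷_ : ∀ {Δ Δs m e s ms es ss u σ M} →
          Δ ⊢⟨ m , e , s ⟩ u ∶ σ →
          Δs ⊢⟨ ms , es , ss ⟩ u ∶* M →
          (Δ +C Δs) ⊢⟨ m + ms , e + es , s + ss ⟩ u ∶* (σ ∷ M)

TightDeriv : ∀ {n} → Ctx n → ℕ → ℕ → ℕ → Term n → Ty → Set
TightDeriv Γ m e s t σ = (Γ ⊢⟨ m , e , s ⟩ t ∶ σ) × TightCtx Γ × IsTight σ

{-# OPTIONS --safe #-}
-- A CBN normal form p has a tight typing with counters (0, 0, |p|): neutral
-- terms get type n, abstractions type a.  Subject expansion carries a typing
-- back along each step: a dB-step trades the es_c rule typing its reduct for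
-- the app_c rule typing its redex (one more m), an sn-step reinstates the es_c
-- rule of the explicit substitution (one more e).  The sn case rests on
-- anti-substitution: a typing of t{x:=u} splits into a typing of t and one
-- typing of u for each type that t assigns to x.  Multitypes are lists, so
-- everything holds only up to multiset equivalence of types and contexts,
-- which preserves tightness.
module Submission where

open import Defs
open import Algebra.Bundles using (CommutativeMonoid)
import Algebra.Properties.CommutativeSemigroup as CommutativeSemigroupProperties
open import Data.Nat using (ℕ; zero; suc; _+_)
open import Data.Nat.Properties using (+-assoc; +-suc; +-identityʳ; +-commutativeSemigroup)
open import Data.Fin using (Fin; zero; suc; punchIn; punchOut; _≟_)
open import Data.Fin.Properties using (punchInᵢ≢i; punchIn-injective; punchIn-punchOut)
open import Data.List using (List; []; _∷_; _++_; [_])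
open import Data.List.Properties using (++-assoc; ++-identityʳ)
open import Data.List.Relation.Unary.All using ([]; _∷_)
open import Data.List.Relation.Binary.Pointwise as Pointwise using (Pointwise; []; _∷_)
open import Data.List.Relation.Binary.Permutation.Propositional
  using (_↭_; refl; prep; swap; trans; ↭-refl; ↭-sym; ↭-trans; ↭-reflexive)
open import Data.List.Relation.Binary.Permutation.Propositional.Properties
  using (All-resp-↭; ++⁺; ++-commutativeMonoid)
open import Data.Product using (Σ; ∃-syntax; _×_; _,_; proj₁; proj₂)
open import Function using (_∘_; id)
open import Relation.Binary using (REL; Reflexive; Symmetric; Transitive; Setoid)
open import Relation.Binary.PropositionalEquality as ≡
  using (_≡_; _≢_; _≗_; refl; sym; cong; cong₂)
import Relation.Binary.Reasoning.Setoid as SetoidReasoning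
open import Relation.Nullary using (yes; no; contradiction)

open CommutativeSemigroupProperties +-commutativeSemigroup
  using () renaming (interchange to +-interchange; xy∙z≈xz∙y to +-swapʳ)
open CommutativeSemigroupProperties
  (CommutativeMonoid.commutativeSemigroup (++-commutativeMonoid {A = Ty}))
  using () renaming (interchange to ++-interchange; xy∙z≈xz∙y to ++-swapʳ)

-- Multiset equivalence of types and contexts

Pointwise-↭ʳ : ∀ {a b ℓ} {A : Set a} {B : Set b} {R : REL A B ℓ} {xs ys ys'} →
               Pointwise R xs ys → ys ↭ ys' → ∃[ xs' ] xs ↭ xs' × Pointwise R xs' ys'
Pointwise-↭ʳ rs refl = _ , refl , rs
Pointwise-↭ʳ (r ∷ rs) (prep _ p) =
  let _ , q , rs' = Pointwise-↭ʳ rs p in _ , prep _ q , r ∷ rs'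
Pointwise-↭ʳ (r ∷ r' ∷ rs) (swap _ _ p) =
  let _ , q , rs' = Pointwise-↭ʳ rs p in _ , swap _ _ q , r' ∷ r ∷ rs'
Pointwise-↭ʳ rs (trans p p') =
  let _ , q , rs' = Pointwise-↭ʳ rs p ; _ , q' , rs'' = Pointwise-↭ʳ rs' p'
  in _ , trans q q' , rs''

Pointwise-↭ˡ : ∀ {a b ℓ} {A : Set a} {B : Set b} {R : REL A B ℓ} {xs xs' ys} →
               xs ↭ xs' → Pointwise R xs' ys → ∃[ ys' ] Pointwise R xs ys' × ys' ↭ ys
Pointwise-↭ˡ p rs =
  let _ , q , rs' = Pointwise-↭ʳ (Pointwise.symmetric id rs) (↭-sym p)
  in _ , Pointwise.symmetric id rs' , ↭-sym q

_≈T⋆_ : List Ty → List Ty → Set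
_≈T⋆_ = Pointwise _≈T_

mutual
  ≈T-refl : Reflexive _≈T_
  ≈T-refl {tight a} = tight≈ a
  ≈T-refl {mty M}   = mty≈ ≈M-refl
  ≈T-refl {M ⇒ σ}   = arr≈ ≈M-refl ≈T-refl

  ≈M-refl : Reflexive _≈M_
  ≈M-refl = bag≈ ↭-refl ≈T⋆-refl

  ≈T⋆-refl : Reflexive _≈T⋆_
  ≈T⋆-refl {[]}    = []
  ≈T⋆-refl {σ ∷ M} = ≈T-refl ∷ ≈T⋆-refl

mutual
  ≈T-sym : Symmetric _≈T_
  ≈T-sym (tight≈ a)  = tight≈ a
  ≈T-sym (mty≈ p)    = mty≈ (≈M-sym p)
  ≈T-sym (arr≈ p q)  = arr≈ (≈M-sym p) (≈T-sym q)

  ≈M-sym : Symmetric _≈M_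
  ≈M-sym (bag≈ p ps) =
    let _ , q , ps' = Pointwise-↭ʳ (≈T⋆-sym ps) (↭-sym p) in bag≈ q ps'

  ≈T⋆-sym : Symmetric _≈T⋆_
  ≈T⋆-sym []       = []
  ≈T⋆-sym (p ∷ ps) = ≈T-sym p ∷ ≈T⋆-sym ps

-- The permutation between the two pointwise parts is pushed to the right,
-- so that the recursion only descends into the first proof.
mutual
  ≈T-trans : Transitive _≈T_
  ≈T-trans (tight≈ a)  q            = q
  ≈T-trans (mty≈ p)    (mty≈ q)     = mty≈ (≈M-trans p q)
  ≈T-trans (arr≈ p p') (arr≈ q q')  = arr≈ (≈M-trans p q) (≈T-trans p' q')

  ≈M-trans : Transitive _≈M_
  ≈M-trans (bag≈ p ps) (bag≈ q qs) =
    let _ , qs' , r = Pointwise-↭ˡ q qs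
        _ , r' , rs = Pointwise-↭ʳ (≈T⋆-trans ps qs') r
    in bag≈ (↭-trans p r') rs

  ≈T⋆-trans : Transitive _≈T⋆_
  ≈T⋆-trans []       []       = []
  ≈T⋆-trans (p ∷ ps) (q ∷ qs) = ≈T-trans p q ∷ ≈T⋆-trans ps qs

↭⇒≈M : ∀ {M N} → M ↭ N → M ≈M N
↭⇒≈M p = bag≈ p ≈T⋆-refl

≡⇒≈M : ∀ {M N} → M ≡ N → M ≈M N
≡⇒≈M refl = ≈M-refl

≈M-++ : ∀ {M M' N N'} → M ≈M M' → N ≈M N' → (M ++ N) ≈M (M' ++ N')
≈M-++ (bag≈ p ps) (bag≈ q qs) = bag≈ (++⁺ p q) (Pointwise.++⁺ ps qs)

≈M-∷ : ∀ {σ τ M N} → σ ≈T τ → M ≈M N → (σ ∷ M) ≈M (τ ∷ N)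
≈M-∷ σ≈τ = ≈M-++ (bag≈ ↭-refl (σ≈τ ∷ []))

IsTight-resp-≈T : ∀ {σ τ} → σ ≈T τ → IsTight σ → IsTight τ
IsTight-resp-≈T (tight≈ a) (tightT a) = tightT a

TightM-resp-≈M : ∀ {M N} → M ≈M N → TightM M → TightM N
TightM-resp-≈M (bag≈ p ps) = tight-pointwise ps ∘ All-resp-↭ p
  where
  tight-pointwise : ∀ {K N} → K ≈T⋆ N → TightM K → TightM N
  tight-pointwise []         []       = []
  tight-pointwise (σ≈ ∷ σs≈) (σt ∷ σts) = IsTight-resp-≈T σ≈ σt ∷ tight-pointwise σs≈ σts

infix 4 _≋_

_≋_ : ∀ {n} → Ctx n → Ctx n → Set
Γ ≋ Δ = ∀ x → Γ x ≈M Δ x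

≋-refl : ∀ {n} → Reflexive (_≋_ {n})
≋-refl _ = ≈M-refl

≋-sym : ∀ {n} → Symmetric (_≋_ {n})
≋-sym p x = ≈M-sym (p x)

≋-trans : ∀ {n} → Transitive (_≋_ {n})
≋-trans p q x = ≈M-trans (p x) (q x)

≋-setoid : ℕ → Setoid _ _
≋-setoid n = record
  { Carrier       = Ctx n
  ; _≈_           = _≋_
  ; isEquivalence = record { refl = ≋-refl ; sym = ≋-sym ; trans = ≋-trans }
  }

≋-+C : ∀ {n} {Γ Γ' Δ Δ' : Ctx n} → Γ ≋ Γ' → Δ ≋ Δ' → Γ +C Δ ≋ Γ' +C Δ'
≋-+C p q x = ≈M-++ (p x) (q x)

+C-assoc : ∀ {n} (Γ Δ Θ : Ctx n) → (Γ +C Δ) +C Θ ≋ Γ +C (Δ +C Θ)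
+C-assoc Γ Δ Θ x = ↭⇒≈M (↭-reflexive (++-assoc (Γ x) (Δ x) (Θ x)))

+C-swapʳ : ∀ {n} (Γ Δ Θ : Ctx n) → (Γ +C Δ) +C Θ ≋ (Γ +C Θ) +C Δ
+C-swapʳ Γ Δ Θ x = ↭⇒≈M (++-swapʳ (Γ x) (Δ x) (Θ x))

+C-interchange : ∀ {n} (Γ Δ Θ Ξ : Ctx n) → (Γ +C Δ) +C (Θ +C Ξ) ≋ (Γ +C Θ) +C (Δ +C Ξ)
+C-interchange Γ Δ Θ Ξ x = ↭⇒≈M (++-interchange (Γ x) (Δ x) (Θ x) (Ξ x))

TightCtx-resp-≋ : ∀ {n} {Γ Δ : Ctx n} → Γ ≋ Δ → TightCtx Γ → TightCtx Δ
TightCtx-resp-≋ p Γ-tight x = TightM-resp-≈M (p x) (Γ-tight x)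

≋-split₀ : ∀ {n} (Γ Δ : Ctx (suc n)) {Γ' : Ctx (suc n)} {Δ' : Ctx n} →
           Γ +C Δ ≋ Γ' → Δ zero ≡ [] → Δ ∘ suc ≗ Δ' →
           Γ zero ≈M Γ' zero × drop0 Γ +C Δ' ≋ drop0 Γ'
≋-split₀ Γ Δ p Δ₀≡[] Δ≗Δ' =
  ≈M-trans (≡⇒≈M (sym (++-identityʳ (Γ zero))))
           (≡.subst (λ N → (Γ zero ++ N) ≈M _) Δ₀≡[] (p zero)) ,
  λ y → ≡.subst (λ N → (Γ (suc y) ++ N) ≈M _) (Δ≗Δ' y) (p (suc y))

single-self : ∀ {n} (x : Fin n) M → single x M x ≡ M
single-self zero    M = refl
single-self (suc x) M = single-self x M

single-≢ : ∀ {n} {x y : Fin n} M → x ≢ y → single x M y ≡ []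
single-≢ {x = zero}  {zero}  M x≢y = contradiction refl x≢y
single-≢ {x = zero}  {suc y} M x≢y = refl
single-≢ {x = suc x} {zero}  M x≢y = refl
single-≢ {x = suc x} {suc y} M x≢y = single-≢ M (x≢y ∘ cong suc)

single-injective : ∀ {n m} {f : Fin n → Fin m} → (∀ {y z} → f y ≡ f z → y ≡ z) →
                   ∀ y z M → single (f y) M (f z) ≡ single y M z
single-injective {f = f} f-inj y z M with y ≟ z
... | yes refl = ≡.trans (single-self (f y) M) (sym (single-self y M))
... | no  y≢z  = ≡.trans (single-≢ M (y≢z ∘ f-inj)) (sym (single-≢ M y≢z))

single-tight : ∀ {n M} (x : Fin n) → TightM M → TightCtx (single x M)
single-tight zero    M-tight zero    = M-tight
single-tight zero    M-tight (suc y) = []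
single-tight (suc x) M-tight zero    = []
single-tight (suc x) M-tight (suc y) = single-tight x M-tight y

_⊢⟨_,_,_⟩_∶≈_ : ∀ {n} → Ctx n → ℕ → ℕ → ℕ → Term n → Ty → Set
Γ ⊢⟨ m , e , s ⟩ t ∶≈ σ = ∃[ σ' ] σ' ≈T σ × Γ ⊢⟨ m , e , s ⟩ t ∶ σ'

_⊢⟨_,_,_⟩_∶*≈_ : ∀ {n} → Ctx n → ℕ → ℕ → ℕ → Term n → MTy → Set
Γ ⊢⟨ m , e , s ⟩ t ∶*≈ N = ∃[ N' ] N' ≈M N × Γ ⊢⟨ m , e , s ⟩ t ∶* N'

⊢-cast : ∀ {n Γ m e s m' e' s'} {t : Term n} {σ} → m ≡ m' → e ≡ e' → s ≡ s' →
         Γ ⊢⟨ m , e , s ⟩ t ∶ σ → Γ ⊢⟨ m' , e' , s' ⟩ t ∶ σ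
⊢-cast refl refl refl D = D

⊢*-cast : ∀ {n Γ m e s m' e' s'} {t : Term n} {M} → m ≡ m' → e ≡ e' → s ≡ s' →
          Γ ⊢⟨ m , e , s ⟩ t ∶* M → Γ ⊢⟨ m' , e' , s' ⟩ t ∶* M
⊢*-cast refl refl refl Ds = Ds

+-regroup : ∀ a b c d {A B} → a + c ≡ A → b + d ≡ B → (a + b) + (c + d) ≡ A + B
+-regroup a b c d refl refl = +-interchange a b c d

+-regroupʳ : ∀ a b c {A} → a + c ≡ A → (a + b) + c ≡ A + b
+-regroupʳ a b c refl = +-swapʳ a b c

suc-+-assoc : ∀ i a b → suc ((i + a) + b) ≡ i + suc (a + b)
suc-+-assoc i a b = ≡.trans (cong suc (+-assoc i a b)) (sym (+-suc i (a + b)))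

⊢*-++ : ∀ {n} {u : Term n} {Δ₁ Δ₂ m₁ e₁ s₁ m₂ e₂ s₂ M₁ M₂} →
        Δ₁ ⊢⟨ m₁ , e₁ , s₁ ⟩ u ∶* M₁ → Δ₂ ⊢⟨ m₂ , e₂ , s₂ ⟩ u ∶* M₂ →
        ∃[ Δ ] Δ ≋ Δ₁ +C Δ₂ × Δ ⊢⟨ m₁ + m₂ , e₁ + e₂ , s₁ + s₂ ⟩ u ∶* (M₁ ++ M₂)
⊢*-++ [] Ds₂ = _ , ≋-refl , Ds₂
⊢*-++ {Δ₂ = Δ₂} (_∷_ {Δ = Δ} {Δs = Δs} {m} {e} {s} {m'} {e'} {s'} D Ds) Ds₂ =
  let Δ' , Δ'≋ , Ds' = ⊢*-++ Ds Ds₂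
  in Δ +C Δ' ,
     ≋-trans (≋-+C ≋-refl Δ'≋) (≋-sym (+C-assoc Δ Δs Δ₂)) ,
     ⊢*-cast (sym (+-assoc m m' _)) (sym (+-assoc e e' _)) (sym (+-assoc s s' _)) (D ∷ Ds')

-- Strengthening

Strengthening : ∀ {n} → Fin (suc n) → Ctx (suc n) → (Ctx n → Set) → Set
Strengthening x Γ P = Γ x ≡ [] × ∃[ Γ' ] Γ ∘ punchIn x ≗ Γ' × P Γ'

extR-punchIn : ∀ {n} {ρ : Ren n (suc n)} {x} → ρ ≗ punchIn x → extR ρ ≗ punchIn (suc x)
extR-punchIn ρ≗ zero    = refl
extR-punchIn ρ≗ (suc y) = cong suc (ρ≗ y)

mutual
  ⊢-strengthen : ∀ {n} {ρ : Ren n (suc n)} {x} → ρ ≗ punchIn x → ∀ u {Γ m e s σ} →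
                 Γ ⊢⟨ m , e , s ⟩ rename ρ u ∶ σ →
                 Strengthening x Γ (λ Γ' → Γ' ⊢⟨ m , e , s ⟩ u ∶ σ)
  ⊢-strengthen {x = x} ρ≗ (var y) (var-c _ σ) rewrite ρ≗ y =
    single-≢ [ σ ] (punchInᵢ≢i x y) , single y [ σ ] ,
    (λ z → single-injective (punchIn-injective x _ _) y z [ σ ]) , var-c y σ
  ⊢-strengthen ρ≗ (lam t) (abs-p D hT) =
    let x∉ , Γ' , Γ≗ , D' = ⊢-strengthen (extR-punchIn ρ≗) t D
    in x∉ , drop0 Γ' , Γ≗ ∘ suc , abs-p D' (≡.subst TightM (Γ≗ zero) hT)
  ⊢-strengthen ρ≗ (lam t) (abs-c {τ = τ} D) =
    let x∉ , Γ' , Γ≗ , D' = ⊢-strengthen (extR-punchIn ρ≗) t D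
    in x∉ , drop0 Γ' , Γ≗ ∘ suc ,
       ≡.subst (λ M → drop0 Γ' ⊢⟨ _ , _ , _ ⟩ lam t ∶ (M ⇒ τ)) (sym (Γ≗ zero)) (abs-c D')
  ⊢-strengthen ρ≗ (app t r) (app-p _ D) =
    let x∉ , Γ' , Γ≗ , D' = ⊢-strengthen ρ≗ t D
    in x∉ , Γ' , Γ≗ , app-p r D'
  ⊢-strengthen ρ≗ (app t r) (app-c D Ds N≈) =
    let x∉ , Γ' , Γ≗ , D' = ⊢-strengthen ρ≗ t D
        x∉' , Δ' , Δ≗ , Ds' = ⊢*-strengthen ρ≗ r Ds
    in cong₂ _++_ x∉ x∉' , Γ' +C Δ' , (λ y → cong₂ _++_ (Γ≗ y) (Δ≗ y)) , app-c D' Ds' N≈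
  ⊢-strengthen ρ≗ (es t r) (es-c D Ds N≈) =
    let x∉ , Γ' , Γ≗ , D' = ⊢-strengthen (extR-punchIn ρ≗) t D
        x∉' , Δ' , Δ≗ , Ds' = ⊢*-strengthen ρ≗ r Ds
    in cong₂ _++_ x∉ x∉' , drop0 Γ' +C Δ' , (λ y → cong₂ _++_ (Γ≗ (suc y)) (Δ≗ y)) ,
       es-c D' Ds' (≡.subst (_ ≈M_) (Γ≗ zero) N≈)

  ⊢*-strengthen : ∀ {n} {ρ : Ren n (suc n)} {x} → ρ ≗ punchIn x → ∀ u {Γ m e s M} →
                  Γ ⊢⟨ m , e , s ⟩ rename ρ u ∶* M →
                  Strengthening x Γ (λ Γ' → Γ' ⊢⟨ m , e , s ⟩ u ∶* M)
  ⊢*-strengthen ρ≗ u [] = refl , ∅ , (λ _ → refl) , []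
  ⊢*-strengthen ρ≗ u (D ∷ Ds) =
    let x∉ , Γ' , Γ≗ , D' = ⊢-strengthen ρ≗ u D
        x∉' , Δ' , Δ≗ , Ds' = ⊢*-strengthen ρ≗ u Ds
    in cong₂ _++_ x∉ x∉' , Γ' +C Δ' , (λ y → cong₂ _++_ (Γ≗ y) (Δ≗ y)) , D' ∷ Ds'

⊢*-strengthen₀ : ∀ {n} (u : Term n) {Γ m e s M} → Γ ⊢⟨ m , e , s ⟩ weaken u ∶* M →
                 Strengthening zero Γ (λ Γ' → Γ' ⊢⟨ m , e , s ⟩ u ∶* M)
⊢*-strengthen₀ = ⊢*-strengthen (λ _ → refl)

-- Anti-substitution

data PunchView {n} (x : Fin (suc n)) : Fin (suc n) → Set where
  hit  : PunchView x x
  miss : ∀ y → PunchView x (punchIn x y)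

punchView : ∀ {n} (x z : Fin (suc n)) → PunchView x z
punchView x z with x ≟ z
... | yes refl = hit
... | no  x≢z  = ≡.subst (PunchView x) (punchIn-punchOut x≢z) (miss (punchOut x≢z))

IsSingleSubst : ∀ {n} → Sub (suc n) n → Fin (suc n) → Term n → Set
IsSingleSubst σ x u = σ x ≡ u × ∀ y → σ (punchIn x y) ≡ var y

sub0-single : ∀ {n} (u : Term n) → IsSingleSubst (sub0 u) zero u
sub0-single u = refl , λ _ → refl

extS-single : ∀ {n} {σ : Sub (suc n) n} {x u} →
              IsSingleSubst σ x u → IsSingleSubst (extS σ) (suc x) (weaken u)
extS-single (σx≡u , σ-miss) =
  cong weaken σx≡u , λ { zero → refl ; (suc y) → cong weaken (σ-miss y) }

-- A typing of t{x:=u}, taken apart into a typing of t (described by T) and a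
-- family typing u once for each type that typing assigns to x.
record Split {n} (x : Fin (suc n)) (u : Term n) (Γ : Ctx n) (m e s : ℕ)
             (T : Ctx (suc n) → ℕ → ℕ → ℕ → Set) : Set where
  constructor split
  field
    {Γt}                : Ctx (suc n)
    {Δ}                 : Ctx n
    {M}                 : MTy
    {mt et st mu eu su} : ℕ
    of-t    : T Γt mt et st
    of-u    : Δ ⊢⟨ mu , eu , su ⟩ u ∶* M
    x-types : M ≈M Γt x
    ctx≋    : (Γt ∘ punchIn x) +C Δ ≋ Γ
    m-sum   : mt + mu ≡ m
    e-sum   : et + eu ≡ e
    s-sum   : st + su ≡ s

module _ {n} {x : Fin (suc n)} {u : Term n} where

  split-hit : ∀ {Γ m e s τ} → Γ ⊢⟨ m , e , s ⟩ u ∶ τ →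
              Split x u Γ m e s (λ Γt a b c → Γt ⊢⟨ a , b , c ⟩ var x ∶≈ τ)
  split-hit {Γ} {m} {e} {s} {τ} D =
    split (τ , ≈T-refl , var-c x τ) (D ∷ []) (≡⇒≈M (sym (single-self x [ τ ]))) Γ≋
          (+-identityʳ m) (+-identityʳ e) (+-identityʳ s)
    where
    Γ≋ : (single x [ τ ] ∘ punchIn x) +C (Γ +C ∅) ≋ Γ
    Γ≋ y rewrite single-≢ [ τ ] (punchInᵢ≢i x y ∘ sym) = ≡⇒≈M (++-identityʳ (Γ y))

  split-miss : ∀ {y Γ m e s τ} → Γ ⊢⟨ m , e , s ⟩ var y ∶ τ →
               Split x u Γ m e s (λ Γt a b c → Γt ⊢⟨ a , b , c ⟩ var (punchIn x y) ∶≈ τ)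
  split-miss (var-c y τ) =
    split (τ , ≈T-refl , var-c (punchIn x y) τ) []
          (≡⇒≈M (sym (single-≢ [ τ ] (punchInᵢ≢i x y))))
          (λ z → ≡⇒≈M (≡.trans (++-identityʳ _)
                                (single-injective (punchIn-injective x _ _) y z [ τ ])))
          refl refl refl

  split-map : ∀ {Γ m e s T T'} → (∀ {Γt a b c} → T Γt a b c → T' Γt a b c) →
              Split x u Γ m e s T → Split x u Γ m e s T'
  split-map f (split dt du M≈ Γ≋ m≡ e≡ s≡) = split (f dt) du M≈ Γ≋ m≡ e≡ s≡

  split-shift : ∀ i j k {Γ m e s T} →
                Split x u Γ m e s (λ Γt a b c → T Γt (i + a) (j + b) (k + c)) →
                Split x u Γ (i + m) (j + e) (k + s) T
  split-shift i j k (split dt du M≈ Γ≋ m≡ e≡ s≡) =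
    split dt du M≈ Γ≋ (shift i m≡) (shift j e≡) (shift k s≡)
    where
    shift : ∀ i {a b c} → a + b ≡ c → (i + a) + b ≡ i + c
    shift i {a} {b} refl = +-assoc i a b

  split-combine : ∀ {Γ₁ Γ₂ m₁ m₂ e₁ e₂ s₁ s₂ T₁ T₂ T} →
                  Split x u Γ₁ m₁ e₁ s₁ T₁ → Split x u Γ₂ m₂ e₂ s₂ T₂ →
                  (∀ {Γa Γb a₁ b₁ c₁ a₂ b₂ c₂} → T₁ Γa a₁ b₁ c₁ → T₂ Γb a₂ b₂ c₂ →
                     T (Γa +C Γb) (a₁ + a₂) (b₁ + b₂) (c₁ + c₂)) →
                  Split x u (Γ₁ +C Γ₂) (m₁ + m₂) (e₁ + e₂) (s₁ + s₂) T
  split-combine {Γ₁} {Γ₂}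
    (split {Γt₁} {Δ₁} {_} {mt₁} {et₁} {st₁} {mu₁} {eu₁} {su₁} dt₁ du₁ M≈₁ Γ≋₁ m≡₁ e≡₁ s≡₁)
    (split {Γt₂} {Δ₂} {_} {mt₂} {et₂} {st₂} {mu₂} {eu₂} {su₂} dt₂ du₂ M≈₂ Γ≋₂ m≡₂ e≡₂ s≡₂) f
    with ⊢*-++ du₁ du₂
  ... | Δ , Δ≋ , du =
    split (f dt₁ dt₂) du (≈M-++ M≈₁ M≈₂) Γ≋
          (+-regroup mt₁ mt₂ mu₁ mu₂ m≡₁ m≡₂) (+-regroup et₁ et₂ eu₁ eu₂ e≡₁ e≡₂)
          (+-regroup st₁ st₂ su₁ su₂ s≡₁ s≡₂)
    where
    open SetoidReasoning (≋-setoid n)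
    Γ≋ : ((Γt₁ +C Γt₂) ∘ punchIn x) +C Δ ≋ Γ₁ +C Γ₂
    Γ≋ = begin
      ((Γt₁ ∘ punchIn x) +C (Γt₂ ∘ punchIn x)) +C Δ
        ≈⟨ ≋-+C ≋-refl Δ≋ ⟩
      ((Γt₁ ∘ punchIn x) +C (Γt₂ ∘ punchIn x)) +C (Δ₁ +C Δ₂)
        ≈⟨ +C-interchange (Γt₁ ∘ punchIn x) (Γt₂ ∘ punchIn x) Δ₁ Δ₂ ⟩
      ((Γt₁ ∘ punchIn x) +C Δ₁) +C ((Γt₂ ∘ punchIn x) +C Δ₂)
        ≈⟨ ≋-+C Γ≋₁ Γ≋₂ ⟩
      Γ₁ +C Γ₂ ∎

split-binder : ∀ {n} {x : Fin (suc n)} {u Γ m e s T T'} →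
               Split (suc x) (weaken u) Γ m e s T →
               (∀ {Γt a b c} → T Γt a b c → Γt zero ≈M Γ zero → T' (drop0 Γt) a b c) →
               Split x u (drop0 Γ) m e s T'
split-binder {x = x} {u} (split {Γt} {Δ} dt du M≈ Γ≋ m≡ e≡ s≡) f =
  let Δ₀≡[] , _ , Δ≗ , du' = ⊢*-strengthen₀ u du
      Γ₀≈ , Γ≋' = ≋-split₀ (Γt ∘ punchIn (suc x)) Δ Γ≋ Δ₀≡[] Δ≗
  in split (f dt Γ₀≈) du' M≈ Γ≋' m≡ e≡ s≡

mutual
  subst-split : ∀ {n} {σ : Sub (suc n) n} {x u} → IsSingleSubst σ x u →
                ∀ t {Γ m e s τ} → Γ ⊢⟨ m , e , s ⟩ subst σ t ∶ τ →
                Split x u Γ m e s (λ Γt a b c → Γt ⊢⟨ a , b , c ⟩ t ∶≈ τ)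
  subst-split {x = x} σ₁ (var z) D with punchView x z
  ... | hit    = split-hit (≡.subst (λ w → _ ⊢⟨ _ , _ , _ ⟩ w ∶ _) (proj₁ σ₁) D)
  ... | miss y = split-miss (≡.subst (λ w → _ ⊢⟨ _ , _ , _ ⟩ w ∶ _) (proj₂ σ₁ y) D)
  subst-split σ₁ (lam t) (abs-c D) =
    split-binder (subst-split (extS-single σ₁) t D)
      λ (_ , τ≈ , D') Γ₀≈ → _ , arr≈ Γ₀≈ τ≈ , abs-c D'
  subst-split σ₁ (lam t) (abs-p D hT) =
    split-shift 0 0 1 (split-binder (subst-split (extS-single σ₁) t D)
      λ { (_ , tight≈ _ , D') Γ₀≈ →
            _ , tight≈ ta , abs-p D' (TightM-resp-≈M (≈M-sym Γ₀≈) hT) })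
  subst-split σ₁ (app t r) (app-p _ D) =
    split-shift 0 0 1 (split-map
      (λ { (_ , tight≈ _ , D') → _ , tight≈ tn , app-p r D' })
      (subst-split σ₁ t D))
  subst-split σ₁ (app t r) (app-c D Ds N≈) =
    split-shift 1 1 0 (split-combine (subst-split σ₁ t D) (subst-split* σ₁ r Ds)
      λ { (_ , arr≈ K≈ τ≈ , D') (_ , N'≈ , Ds') →
            _ , τ≈ , app-c D' Ds' (≈M-trans N'≈ (≈M-trans N≈ (≈M-sym K≈))) })
  -- The body lives under the binder of the substitution, so its predicate is
  -- stated before the typing of r is known and only later applied to it.
  subst-split σ₁ (es t r) {τ = τ} (es-c {N = N} D Ds N≈) =
    split-shift 0 1 0 (split-combine
      (split-binder
        {T' = λ Γt a b c → ∀ {Δ a' b' c' N'} → Δ ⊢⟨ a' , b' , c' ⟩ r ∶* N' → N' ≈M N →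
                           (Γt +C Δ) ⊢⟨ a + a' , suc (b + b') , c + c' ⟩ es t r ∶≈ τ}
        (subst-split (extS-single σ₁) t D)
        λ (_ , τ≈ , D') Γ₀≈ Ds' N'≈ →
          _ , τ≈ , es-c D' Ds' (≈M-trans N'≈ (≈M-trans N≈ (≈M-sym Γ₀≈))))
      (subst-split* σ₁ r Ds)
      λ body (_ , N'≈ , Ds') → body Ds' N'≈)

  subst-split* : ∀ {n} {σ : Sub (suc n) n} {x u} → IsSingleSubst σ x u →
                 ∀ t {Γ m e s N} → Γ ⊢⟨ m , e , s ⟩ subst σ t ∶* N →
                 Split x u Γ m e s (λ Γt a b c → Γt ⊢⟨ a , b , c ⟩ t ∶*≈ N)
  subst-split* σ₁ t [] = split (_ , ≈M-refl , []) [] ≈M-refl ≋-refl refl refl refl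
  subst-split* σ₁ t (D ∷ Ds) =
    split-combine (subst-split σ₁ t D) (subst-split* σ₁ t Ds)
      λ (_ , τ≈ , D') (_ , N≈ , Ds') → _ , ≈M-∷ τ≈ N≈ , D' ∷ Ds'

-- Subject expansion

record RedexSplit {n k} (L : LCtx n k) (t : Term (suc k)) (u : Term n)
                  (Γ : Ctx n) (m e s : ℕ) (σ : Ty) : Set where
  constructor redex-split
  field
    {Γf Δu}             : Ctx n
    {M K}               : MTy
    {mf ef sf mu eu su} : ℕ
    of-fun : Γf ⊢⟨ mf , ef , sf ⟩ plug L (lam t) ∶ (M ⇒ σ)
    of-arg : Δu ⊢⟨ mu , eu , su ⟩ u ∶* K
    K≈M    : K ≈M M
    ctx≋   : Γf +C Δu ≋ Γ
    m-sum  : mf + mu ≡ m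
    e-sum  : suc (ef + eu) ≡ e
    s-sum  : sf + su ≡ s

dB-split : ∀ {n k} (L : LCtx n k) t u {Γ m e s σ} →
           Γ ⊢⟨ m , e , s ⟩ plug L (es t (liftL L u)) ∶ σ → RedexSplit L t u Γ m e s σ
dB-split hole t u (es-c D Ds N≈) = redex-split (abs-c D) Ds N≈ ≋-refl refl refl refl
dB-split (ext L r) t u (es-c {Δ = Δr} {m' = mr} {e' = er} {s' = sr} D Dr N≈)
  with dB-split L t (weaken u) D
... | redex-split {Γf} {Δu} {_} {_} {mf} {ef} {sf} {mu} {eu} {su} Df Du K≈M Γ≋ m≡ e≡ s≡ =
  let Δ₀≡[] , Δu' , Δ≗ , Du' = ⊢*-strengthen₀ u Du
      Γ₀≈ , Γ≋' = ≋-split₀ Γf Δu Γ≋ Δ₀≡[] Δ≗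
  in redex-split (es-c Df Dr (≈M-trans N≈ (≈M-sym Γ₀≈))) Du' K≈M
       (≋-trans (+C-swapʳ (drop0 Γf) Δr Δu') (≋-+C Γ≋' ≋-refl))
       (+-regroupʳ mf mr mu m≡) (cong suc (+-regroupʳ (suc ef) er eu e≡))
       (+-regroupʳ sf sr su s≡)

#m #e : Kind → ℕ
#m mul  = 1
#m expo = 0
#e mul  = 0
#e expo = 1

⊢-expand : ∀ {n k} {t t' : Term n} → t ⟶n[ k ] t' → ∀ {Γ m e s σ} →
           Γ ⊢⟨ m , e , s ⟩ t' ∶ σ →
           ∃[ Γ' ] Γ' ≋ Γ × Γ' ⊢⟨ #m k + m , #e k + e , s ⟩ t ∶≈ σ
⊢-expand (dB L t u) D =
  let redex-split Df Du K≈M Γ≋ m≡ e≡ s≡ = dB-split L t u D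
  in _ , Γ≋ , _ , ≈T-refl , ⊢-cast (cong suc m≡) e≡ s≡ (app-c Df Du K≈M)
⊢-expand (sn t u) D =
  let split (_ , σ≈ , Dt) Du M≈ Γ≋ m≡ e≡ s≡ = subst-split (sub0-single u) t D
  in _ , Γ≋ , _ , σ≈ , ⊢-cast m≡ (cong suc e≡) s≡ (es-c Dt Du M≈)
⊢-expand (appL u st) (app-p _ D) with ⊢-expand st D
... | _ , Γ≋ , _ , tight≈ _ , D' = _ , Γ≋ , _ , tight≈ tn , app-p u D'
⊢-expand {k = k} (appL u st) (app-c D Ds N≈) with ⊢-expand st D
... | _ , Γ≋ , _ , arr≈ K≈ τ≈ , D' =
  _ , ≋-+C Γ≋ ≋-refl , _ , τ≈ ,
  ⊢-cast (suc-+-assoc (#m k) _ _) (suc-+-assoc (#e k) _ _) refl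
         (app-c D' Ds (≈M-trans N≈ (≈M-sym K≈)))
⊢-expand (lamN st) (abs-p D hT) with ⊢-expand st D
... | _ , Γ≋ , _ , tight≈ _ , D' =
  _ , Γ≋ ∘ suc , _ , tight≈ ta , abs-p D' (TightM-resp-≈M (≈M-sym (Γ≋ zero)) hT)
⊢-expand (lamN st) (abs-c D) with ⊢-expand st D
... | _ , Γ≋ , _ , τ≈ , D' = _ , Γ≋ ∘ suc , _ , arr≈ (Γ≋ zero) τ≈ , abs-c D'
⊢-expand {k = k} (esL u st) (es-c D Ds N≈) with ⊢-expand st D
... | _ , Γ≋ , _ , τ≈ , D' =
  _ , ≋-+C (Γ≋ ∘ suc) ≋-refl , _ , τ≈ ,
  ⊢-cast (+-assoc (#m k) _ _) (suc-+-assoc (#e k) _ _) refl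
         (es-c D' Ds (≈M-trans N≈ (≈M-sym (Γ≋ zero))))

TightlyTypable : ∀ {n} → Term n → ℕ → ℕ → ℕ → Set
TightlyTypable {n} t m e s = Σ (Ctx n) λ Γ → Σ Ty λ σ → TightDeriv Γ m e s t σ

tight-expand : ∀ {n k} {t t' : Term n} {m e s} → t ⟶n[ k ] t' →
               TightlyTypable t' m e s → TightlyTypable t (#m k + m) (#e k + e) s
tight-expand st (_ , _ , D , Γ-tight , σ-tight) =
  let Γ' , Γ≋ , σ' , σ≈ , D' = ⊢-expand st D
  in Γ' , σ' , D' , TightCtx-resp-≋ (≋-sym Γ≋) Γ-tight , IsTight-resp-≈T (≈T-sym σ≈) σ-tight

-- Normal forms

neutral-typable : ∀ {n} {p : Term n} → NeN p →
                  Σ (Ctx n) λ Γ → TightCtx Γ × Γ ⊢⟨ 0 , 0 , size p ⟩ p ∶ tight tn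
neutral-typable (var x) =
  single x [ tight tn ] , single-tight x (tightT tn ∷ []) , var-c x (tight tn)
neutral-typable (app t-ne u) =
  let Γ , Γ-tight , D = neutral-typable t-ne in Γ , Γ-tight , app-p u D

normal-typable : ∀ {n} {p : Term n} → NoN p → TightlyTypable p 0 0 (size p)
normal-typable (lam nf) with normal-typable nf
... | Γ , _ , D , Γ-tight , tightT _ =
  drop0 Γ , tight ta , abs-p D (Γ-tight zero) , Γ-tight ∘ suc , tightT ta
normal-typable (ne p-ne) =
  let Γ , Γ-tight , D = neutral-typable p-ne in Γ , tight tn , D , Γ-tight , tightT tn

theorem3p10 : ∀ {n : ℕ} (t p : Term n) (m e : ℕ) →
    t ⟶n*⟨ m , e ⟩ p → NoN p →
    Σ (Ctx n) λ Γ → Σ Ty λ σ → TightDeriv Γ m e (size p) t σ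
theorem3p10 t .t .0 .0 done nf = normal-typable nf
theorem3p10 t p (suc m) e (stepM st steps) nf = tight-expand st (theorem3p10 _ p m e steps nf)
theorem3p10 t p m (suc e) (stepE st steps) nf = tight-expand st (theorem3p10 _ p m e steps nf)
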